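{- Let $T$ be a tree with at least two vertices. If $D_{pr}$ is the unique minimum paired-dominating set of $T$, then $T$ has a unique minimum edge-vertex dominating set $D_{ev}$, and $D_{ev}$ is the (unique) perfect matching of the induced subgraph $T[D_{pr}]$, so that $V_T(D_{ev})=D_{pr}$. Analogously, if $D_{ev}$ is the unique minimum edge-vertex dominating set of $T$, then $T$ has a unique minimum paired-dominating set, namely $V_T(D_{ev})$.
   Context: All graphs are finite and simple. For $M\subseteq E_T$, $V_T(M)$ denotes the set of vertices incident to edges of $M$. A set $D\subseteq V_T$ is dominating if every vertex outside $D$ has a neighbour in $D$; it is a paired-dominating set if it is dominating and the induced subgraph $T[D]$ has a perfect matching; minimum means of minimum cardinality. An edge $e$ ev-dominates a vertex $v$ if $e$ is incident to $v$ or $e$ is incident to a vertex adjacent to $v$. A set $M\subseteq E_T$ is an edge-vertex dominating set if every vertex is ev-dominated by some edge of $M$; minimum means of minimum cardinality. -}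

module Defs where

open import Data.Nat using (ℕ; zero; suc; _+_; _≤_)
open import Data.Bool using (Bool; true; false; _∧_; _∨_; if_then_else_)
open import Data.Fin using (Fin; zero; suc; toℕ)
open import Data.Fin.Subset using (Subset; _∈_; ∣_∣)
open import Data.Vec using (tabulate)
open import Data.List using (List; []; _∷_; length; _∷ʳ_)
open import Data.List.Relation.Unary.Linked using (Linked)
open import Data.List.Relation.Unary.Unique.Propositional using (Unique)
open import Data.Product using (Σ; ∃; _×_)
open import Data.Sum using (_⊎_)
open import Relation.Binary.PropositionalEquality using (_≡_)
open import Relation.Nullary using (¬_)
import Data.Nat as ℕ

record Graph (n : ℕ) : Set where
  field
    adj   : Fin n → Fin n → Bool
    sym   : ∀ u v → adj u v ≡ adj v u
    irrefl : ∀ u → adj u u ≡ false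
open Graph public

Adj : ∀ {n} → Graph n → Fin n → Fin n → Set
Adj G u v = adj G u v ≡ true

Connected : ∀ {n} → Graph n → Set
Connected {n} G = ∀ (u v : Fin n) →
  u ≡ v ⊎ Σ (List (Fin n)) (λ vs → Linked (Adj G) (u ∷ (vs ∷ʳ v)))

HasCycle : ∀ {n} → Graph n → Set
HasCycle {n} G = Σ (Fin n) λ v → Σ (List (Fin n)) λ rest →
  (3 ≤ length (v ∷ rest)) × Unique (v ∷ rest) × Linked (Adj G) (v ∷ (rest ∷ʳ v))

Acyclic : ∀ {n} → Graph n → Set
Acyclic G = ¬ HasCycle G

IsTree : ∀ {n} → Graph n → Set
IsTree G = Connected G × Acyclic G

Dominating : ∀ {n} → Graph n → Subset n → Set
Dominating {n} G D = ∀ (v : Fin n) → v ∈ D ⊎ Σ (Fin n) (λ u → u ∈ D × Adj G v u)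

EdgeFun : ℕ → Set
EdgeFun n = Fin n → Fin n → Bool

IsEdgeSet : ∀ {n} → Graph n → EdgeFun n → Set
IsEdgeSet {n} G M = (∀ (u v : Fin n) → M u v ≡ true → Adj G u v)
                  × (∀ (u v : Fin n) → M u v ≡ M v u)

_≐_ : ∀ {n} → EdgeFun n → EdgeFun n → Set
_≐_ {n} M N = ∀ (u v : Fin n) → M u v ≡ N u v

countFin : ∀ {n} → (Fin n → Bool) → ℕ
countFin {zero} f = 0
countFin {suc n} f = (if f zero then 1 else 0) + countFin (λ i → f (suc i))

sumFin : ∀ {n} → (Fin n → ℕ) → ℕ
sumFin {zero} f = 0
sumFin {suc n} f = f zero + sumFin (λ i → f (suc i))

anyFin : ∀ {n} → (Fin n → Bool) → Bool
anyFin {zero} f = false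
anyFin {suc n} f = f zero ∨ anyFin (λ i → f (suc i))

-- number of edges {u,v} in M (each counted once, via u < v)
edgeCount : ∀ {n} → EdgeFun n → ℕ
edgeCount M = sumFin (λ u → countFin (λ v → (toℕ u ℕ.<ᵇ toℕ v) ∧ M u v))

VT : ∀ {n} → EdgeFun n → Subset n
VT M = tabulate (λ u → anyFin (λ v → M u v))

PerfectMatchingOf : ∀ {n} → Graph n → Subset n → EdgeFun n → Set
PerfectMatchingOf {n} G D M =
  IsEdgeSet G M
  × (∀ (u v : Fin n) → M u v ≡ true → u ∈ D × v ∈ D)
  × (∀ (u : Fin n) → u ∈ D →
       Σ (Fin n) λ v → M u v ≡ true × (∀ (w : Fin n) → M u w ≡ true → w ≡ v))

PairedDominating : ∀ {n} → Graph n → Subset n → Set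
PairedDominating {n} G D = Dominating G D × Σ (EdgeFun n) (PerfectMatchingOf G D)

MinPairedDominating : ∀ {n} → Graph n → Subset n → Set
MinPairedDominating {n} G D =
  PairedDominating G D × (∀ (D' : Subset n) → PairedDominating G D' → ∣ D ∣ ≤ ∣ D' ∣)

UniqueMinPairedDominating : ∀ {n} → Graph n → Subset n → Set
UniqueMinPairedDominating {n} G D =
  MinPairedDominating G D × (∀ (D' : Subset n) → MinPairedDominating G D' → D' ≡ D)

EvDominates : ∀ {n} → Graph n → Fin n → Fin n → Fin n → Set
EvDominates G u w v = v ≡ u ⊎ v ≡ w ⊎ Adj G v u ⊎ Adj G v w

EdgeVertexDominating : ∀ {n} → Graph n → EdgeFun n → Set
EdgeVertexDominating {n} G M =
  IsEdgeSet G M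
  × (∀ (v : Fin n) → Σ (Fin n) λ u → Σ (Fin n) λ w → M u w ≡ true × EvDominates G u w v)

MinEdgeVertexDominating : ∀ {n} → Graph n → EdgeFun n → Set
MinEdgeVertexDominating {n} G M =
  EdgeVertexDominating G M
  × (∀ (M' : EdgeFun n) → EdgeVertexDominating G M' → edgeCount M ≤ edgeCount M')

UniqueMinEdgeVertexDominating : ∀ {n} → Graph n → EdgeFun n → Set
UniqueMinEdgeVertexDominating {n} G M =
  MinEdgeVertexDominating G M
  × (∀ (M' : EdgeFun n) → MinEdgeVertexDominating G M' → M' ≐ M)

-- A paired-dominating set D with perfect matching M makes M an edge-vertex
-- dominating set with 2|M| = |D|.  Conversely, going through the edges of an
-- ev-dominating set M one at a time and greedily matching the still unmatched
-- vertices of V(M) gives a paired-dominating set of size at most 2|M| whose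
-- matching contains any prescribed edge of M.  So when no vertex is isolated
-- the two kinds of minimum sets correspond, and uniqueness transfers: if M is
-- the unique minimum ev-dominating set, every greedy paired-dominating set is
-- matched by a minimum ev-dominating set, i.e. by M, so it is V(M); if D is the
-- unique minimum paired-dominating set of a tree, every edge of a minimum
-- ev-dominating set lies in a paired-dominating set of size |D|, i.e. in D, and
-- is an edge of its perfect matching, which is unique in a forest because two
-- different perfect matchings of D span an alternating walk that closes a cycle.

module Submission where

open import Defs hiding (sym)
open import Algebra.Properties.CommutativeMonoid.Sum as MonoidSum using ()
import Data.Bool as Bool
open import Data.Bool using (Bool; true; false; _∧_; _∨_; _xor_; not; if_then_else_)
open import Data.Bool.Properties using (T-≡; ¬-not; ∧-zeroʳ; ∨-zeroʳ; not-involutive)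
open import Data.Empty using (⊥-elim)
open import Data.Fin as Fin using (Fin; zero; suc; toℕ)
open import Data.Fin.Properties using (suc-injective; 0≢1+n; <-cmp; any?; pigeonhole) renaming (_≟_ to _≟ᶠ_)
open import Data.Fin.Subset using (Subset; _∈_; _∉_; _⊆_; _∪_; _-_; ⁅_⁆; ∣_∣) renaming (⊥ to ∅)
open import Data.Fin.Subset.Properties
  using ( _∈?_; ⊆-antisym; p⊆q⇒∣p∣≤∣q∣; p⊆p∪q; x∈p∪q⁺; x∈p∪q⁻; x∈⁅x⁆; x∈⁅y⁆⇒x≡y; ∣⁅x⁆∣≡1; ∣⊥∣≡0
        ; p─q⊆p; x∈p∧x≢y⇒x∈p-y)
open import Data.List as List using (List; []; _∷_; _++_; _∷ʳ_; length)
open import Data.List.Membership.Propositional using (lose) renaming (_∈_ to _∈ₗ_)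
open import Data.List.Membership.Propositional.Properties
  using (∈-map⁺; ∈-map⁻; ∈-++⁺ˡ; ∈-++⁺ʳ; ∈-++⁻; ∈-∃++)
open import Data.List.Properties using (length-map; length-++; length-++-sucʳ)
open import Data.List.Relation.Unary.All as All using (All; []; _∷_)
open import Data.List.Relation.Unary.AllPairs using ([]; _∷_)
open import Data.List.Relation.Unary.Any using (Any; here; there)
open import Data.List.Relation.Unary.Linked using (Linked; []; [-]; _∷_)
open import Data.List.Relation.Unary.Unique.Propositional using (Unique)
import Data.Nat as ℕ
open import Data.Nat using (ℕ; zero; suc; _+_; _*_; _≤_; _<_; _<ᵇ_; z≤n; s≤s; z<s; s<s; s≤s⁻¹)
open import Data.Nat.Properties
  using ( +-0-commutativeMonoid; +-identityʳ; +-comm; +-suc; *-suc; ≤-reflexive; ≤-trans; n≤1+n; n<1+n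
        ; m≤m+n; m≤n+m; +-monoˡ-≤; +-monoʳ-≤; +-monoʳ-<; *-monoʳ-≤; *-cancelˡ-≤; ≤∧≢⇒<
        ; <⇒<ᵇ; <ᵇ⇒<
        ; m≤n⇒∃[o]m+o≡n; anyUpTo?; module ≤-Reasoning)
open import Data.Nat.Tactic.RingSolver using (solve-∀)
open import Data.Product as Prod using (Σ; ∃; _×_; _,_; proj₁; proj₂; uncurry)
open import Data.Sum as Sum using (_⊎_; inj₁; inj₂)
open import Data.Vec using (_∷_; []; here; there; lookup)
open import Data.Vec.Properties using (lookup∘tabulate; []=⇒lookup; lookup⇒[]=)
open import Function using (_∘_; Equivalence; mk⇔)
open import Relation.Binary.Definitions using (tri<; tri≈; tri>)
open import Relation.Binary.PropositionalEquality
open import Relation.Nullary using (¬_; ¬?; Dec; yes; no; does; _×-dec_; _⊎-dec_)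
open import Relation.Nullary.Decidable using (dec-true; dec-false; does-⇔)
import Relation.Unary as U

open MonoidSum +-0-commutativeMonoid using (sum; sum-cong-≗; ∑-distrib-+; ∑-comm)

true≢false : true ≢ false
true≢false ()

ind : Bool → ℕ
ind b = if b then 1 else 0

sumFin≡sum : ∀ {n} (f : Fin n → ℕ) → sumFin f ≡ sum f
sumFin≡sum {zero}  f = refl
sumFin≡sum {suc n} f = cong (f zero +_) (sumFin≡sum (f ∘ suc))

sumFin-cong : ∀ {n} {f g : Fin n → ℕ} → (∀ x → f x ≡ g x) → sumFin f ≡ sumFin g
sumFin-cong {zero}  f≗g = refl
sumFin-cong {suc n} f≗g = cong₂ _+_ (f≗g zero) (sumFin-cong (f≗g ∘ suc))

countFin≡sum : ∀ {n} (f : Fin n → Bool) → countFin f ≡ sum (ind ∘ f)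
countFin≡sum {zero}  f = refl
countFin≡sum {suc n} f = cong (ind (f zero) +_) (countFin≡sum (f ∘ suc))

countFin-≡0 : ∀ {n} (f : Fin n → Bool) → (∀ x → f x ≡ false) → countFin f ≡ 0
countFin-≡0 {zero}  f none = refl
countFin-≡0 {suc n} f none rewrite none zero = countFin-≡0 (f ∘ suc) (none ∘ suc)

countFin-≡1 : ∀ {n} (f : Fin n → Bool) {y} → f y ≡ true → (∀ x → f x ≡ true → x ≡ y) →
              countFin f ≡ 1
countFin-≡1 {suc n} f {zero} fy only rewrite fy =
  cong suc (countFin-≡0 (f ∘ suc) λ x → ¬-not λ fx → 0≢1+n (sym (only (suc x) fx)))
countFin-≡1 {suc n} f {suc y} fy only
  rewrite ¬-not {f zero} {true} (λ f0 → 0≢1+n (only zero f0)) =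
  countFin-≡1 (f ∘ suc) fy (λ x fx → suc-injective (only (suc x) fx))

Ascending : ∀ {n} → EdgeFun n → EdgeFun n
Ascending M u v = (toℕ u <ᵇ toℕ v) ∧ M u v

edgeCount≡sum : ∀ {n} (M : EdgeFun n) → edgeCount M ≡ sum (λ u → sum (ind ∘ Ascending M u))
edgeCount≡sum M = trans (sumFin≡sum (countFin ∘ Ascending M)) (sum-cong-≗ (countFin≡sum ∘ Ascending M))

<ᵇ-true : ∀ {m n} → m < n → (m <ᵇ n) ≡ true
<ᵇ-true = Equivalence.to T-≡ ∘ <⇒<ᵇ

<ᵇ-false : ∀ {m n} → ¬ m < n → (m <ᵇ n) ≡ false
<ᵇ-false ¬m<n = ¬-not (¬m<n ∘ <ᵇ⇒< _ _ ∘ Equivalence.from T-≡)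

orientation : ∀ {n} (u v : Fin n) → u ≢ v → (toℕ u <ᵇ toℕ v) xor (toℕ v <ᵇ toℕ u) ≡ true
orientation u v u≢v with <-cmp u v
... | tri< u<v _ v≮u rewrite <ᵇ-true u<v | <ᵇ-false v≮u = refl
... | tri≈ _ u≡v _   = ⊥-elim (u≢v u≡v)
... | tri> u≮v _ v<u rewrite <ᵇ-false u≮v | <ᵇ-true v<u = refl

ind-split : ∀ b c d → (b ≡ true → c xor d ≡ true) → ind b ≡ ind (c ∧ b) + ind (d ∧ b)
ind-split false c     d     _   rewrite ∧-zeroʳ c | ∧-zeroʳ d = refl
ind-split true  true  false _   = refl
ind-split true  false true  _   = refl
ind-split true  true  true  one with () ← one refl
ind-split true  false false one with () ← one refl

handshake : ∀ {n} (M : EdgeFun n) → (∀ u v → M u v ≡ M v u) → (∀ u → M u u ≡ false) →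
            sumFin (λ u → countFin (M u)) ≡ 2 * edgeCount M
handshake M symm loopless = begin
  sumFin (countFin ∘ M)
    ≡⟨ trans (sumFin≡sum (countFin ∘ M)) (sum-cong-≗ (countFin≡sum ∘ M)) ⟩
  sum (λ u → sum (λ v → ind (M u v)))
    ≡⟨ sum-cong-≗ (λ u → sum-cong-≗ (split u)) ⟩
  sum (λ u → sum (λ v → ind (Ascending M u v) + ind (Ascending M v u)))
    ≡⟨ sum-cong-≗ (λ u → ∑-distrib-+ (ind ∘ Ascending M u) (λ v → ind (Ascending M v u))) ⟩
  sum (λ u → sum (ind ∘ Ascending M u) + sum (λ v → ind (Ascending M v u)))
    ≡⟨ ∑-distrib-+ (λ u → sum (ind ∘ Ascending M u)) (λ u → sum (λ v → ind (Ascending M v u))) ⟩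
  e + sum (λ u → sum (λ v → ind (Ascending M v u)))
    ≡⟨ cong (e +_) (∑-comm (λ u v → ind (Ascending M v u))) ⟩
  e + e
    ≡⟨ cong₂ _+_ (edgeCount≡sum M) (trans (+-identityʳ _) (edgeCount≡sum M)) ⟨
  2 * edgeCount M
    ∎
  where
  open ≡-Reasoning
  e : ℕ
  e = sum (λ u → sum (ind ∘ Ascending M u))
  split : ∀ u v → ind (M u v) ≡ ind (Ascending M u v) + ind (Ascending M v u)
  split u v = trans
    (ind-split (M u v) (toℕ u <ᵇ toℕ v) (toℕ v <ᵇ toℕ u)
      λ Muv → orientation u v λ { refl → true≢false (trans (sym Muv) (loopless u)) })
    (cong (λ b → ind (Ascending M u v) + ind ((toℕ v <ᵇ toℕ u) ∧ b)) (symm u v))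

∣p∣≡countFin : ∀ {n} (p : Subset n) → ∣ p ∣ ≡ countFin (lookup p)
∣p∣≡countFin []          = refl
∣p∣≡countFin (true ∷ p)  = cong suc (∣p∣≡countFin p)
∣p∣≡countFin (false ∷ p) = ∣p∣≡countFin p

∣p∪q∣≤∣p∣+∣q∣ : ∀ {n} (p q : Subset n) → ∣ p ∪ q ∣ ≤ ∣ p ∣ + ∣ q ∣
∣p∪q∣≤∣p∣+∣q∣ []          []          = z≤n
∣p∪q∣≤∣p∣+∣q∣ (true ∷ p)  (true ∷ q)  = s≤s (≤-trans (∣p∪q∣≤∣p∣+∣q∣ p q) (+-monoʳ-≤ ∣ p ∣ (n≤1+n ∣ q ∣)))
∣p∪q∣≤∣p∣+∣q∣ (true ∷ p)  (false ∷ q) = s≤s (∣p∪q∣≤∣p∣+∣q∣ p q)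
∣p∪q∣≤∣p∣+∣q∣ (false ∷ p) (true ∷ q)  = subst (suc ∣ p ∪ q ∣ ≤_) (sym (+-suc ∣ p ∣ ∣ q ∣)) (s≤s (∣p∪q∣≤∣p∣+∣q∣ p q))
∣p∪q∣≤∣p∣+∣q∣ (false ∷ p) (false ∷ q) = ∣p∪q∣≤∣p∣+∣q∣ p q

x∉p-x : ∀ {n} (x : Fin n) (p : Subset n) → x ∉ p - x
x∉p-x zero    (s ∷ p) ()
x∉p-x (suc x) (s ∷ p) (there x∈p-x) = x∉p-x x p x∈p-x

anyFin⁺ : ∀ {n} (f : Fin n → Bool) {x} → f x ≡ true → anyFin f ≡ true
anyFin⁺ f {zero}  fx rewrite fx = refl
anyFin⁺ f {suc x} fx = trans (cong (f zero ∨_) (anyFin⁺ (f ∘ suc) fx)) (∨-zeroʳ (f zero))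

anyFin⁻ : ∀ {n} (f : Fin n → Bool) → anyFin f ≡ true → ∃ λ x → f x ≡ true
anyFin⁻ {suc n} f any with f zero in f0
... | true  = zero , f0
... | false = let x , fx = anyFin⁻ (f ∘ suc) any in suc x , fx

-- Edge sets and matchings

_⊆ₑ_ : ∀ {n} → EdgeFun n → EdgeFun n → Set
M ⊆ₑ N = ∀ x y → M x y ≡ true → N x y ≡ true

∈VT⁺ : ∀ {n} (M : EdgeFun n) {x y} → M x y ≡ true → x ∈ VT M
∈VT⁺ M {x} Mxy = lookup⇒[]= x (VT M) (trans (lookup∘tabulate _ x) (anyFin⁺ (M x) Mxy))

∈VT⁻ : ∀ {n} (M : EdgeFun n) {x} → x ∈ VT M → ∃ λ y → M x y ≡ true
∈VT⁻ M {x} x∈VT = anyFin⁻ (M x) (trans (sym (lookup∘tabulate _ x)) ([]=⇒lookup x∈VT))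

VT-mono : ∀ {n} {M N : EdgeFun n} → M ⊆ₑ N → VT M ⊆ VT N
VT-mono {M = M} {N} M⊆N x∈VT = let y , Mxy = ∈VT⁻ M x∈VT in ∈VT⁺ N (M⊆N _ y Mxy)

VT-cong : ∀ {n} {M N : EdgeFun n} → M ≐ N → VT M ≡ VT N
VT-cong M≐N = ⊆-antisym (VT-mono λ x y → trans (sym (M≐N x y))) (VT-mono λ x y → trans (M≐N x y))

noEdges : ∀ {n} → EdgeFun n
noEdges _ _ = false

∉VT-noEdges : ∀ {n} {x : Fin n} → x ∉ VT noEdges
∉VT-noEdges x∈VT = true≢false (sym (proj₂ (∈VT⁻ noEdges x∈VT)))

∣VT-noEdges∣ : ∀ {n} → ∣ VT (noEdges {n}) ∣ ≤ 0
∣VT-noEdges∣ {n} =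
  ≤-trans (p⊆q⇒∣p∣≤∣q∣ {p = VT (noEdges {n})} {q = ∅ {n}} (⊥-elim ∘ ∉VT-noEdges)) (≤-reflexive (∣⊥∣≡0 n))

SameEdge : ∀ {n} → Fin n → Fin n → Fin n → Fin n → Set
SameEdge x y u w = (x ≡ u × y ≡ w) ⊎ (x ≡ w × y ≡ u)

sameEdge? : ∀ {n} (x y u w : Fin n) → Dec (SameEdge x y u w)
sameEdge? x y u w = (x ≟ᶠ u ×-dec y ≟ᶠ w) ⊎-dec (x ≟ᶠ w ×-dec y ≟ᶠ u)

SameEdge-sym : ∀ {n} {x y u w : Fin n} → SameEdge x y u w → SameEdge y x u w
SameEdge-sym = Sum.swap ∘ Sum.map Prod.swap Prod.swap

addEdge : ∀ {n} → EdgeFun n → Fin n → Fin n → EdgeFun n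
addEdge M u w x y = M x y ∨ does (sameEdge? x y u w)

module _ {n} {M : EdgeFun n} {u w : Fin n} where

  addEdge⁺ : M ⊆ₑ addEdge M u w
  addEdge⁺ x y Mxy rewrite Mxy = refl

  addEdge-new : addEdge M u w u w ≡ true
  addEdge-new = trans (cong (M u w ∨_) (dec-true (sameEdge? u w u w) (inj₁ (refl , refl)))) (∨-zeroʳ _)

  addEdge-new′ : addEdge M u w w u ≡ true
  addEdge-new′ = trans (cong (M w u ∨_) (dec-true (sameEdge? w u u w) (inj₂ (refl , refl)))) (∨-zeroʳ _)

  addEdge⁻ : ∀ {x y} → addEdge M u w x y ≡ true → M x y ≡ true ⊎ SameEdge x y u w
  addEdge⁻ {x} {y} e with M x y | sameEdge? x y u w
  ... | true  | _        = inj₁ refl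
  ... | false | yes same = inj₂ same
  ... | false | no ¬same = ⊥-elim (true≢false (trans (sym e) (dec-false (sameEdge? x y u w) ¬same)))

  addEdge-sym : (∀ x y → M x y ≡ M y x) → ∀ x y → addEdge M u w x y ≡ addEdge M u w y x
  addEdge-sym symm x y =
    cong₂ _∨_ (symm x y) (does-⇔ (mk⇔ SameEdge-sym SameEdge-sym) (sameEdge? x y u w) (sameEdge? y x u w))

VT-addEdge : ∀ {n} (M : EdgeFun n) u w → VT (addEdge M u w) ⊆ VT M ∪ (⁅ u ⁆ ∪ ⁅ w ⁆)
VT-addEdge M u w x∈VT with ∈VT⁻ (addEdge M u w) x∈VT
... | y , e with addEdge⁻ {M = M} e
...   | inj₁ Mxy               = x∈p∪q⁺ (inj₁ (∈VT⁺ M Mxy))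
...   | inj₂ (inj₁ (refl , _)) = x∈p∪q⁺ (inj₂ (x∈p∪q⁺ (inj₁ (x∈⁅x⁆ u))))
...   | inj₂ (inj₂ (refl , _)) = x∈p∪q⁺ (inj₂ (x∈p∪q⁺ (inj₂ (x∈⁅x⁆ w))))

∣VT-addEdge∣ : ∀ {n} (M : EdgeFun n) u w → ∣ VT (addEdge M u w) ∣ ≤ 2 + ∣ VT M ∣
∣VT-addEdge∣ M u w = begin
  ∣ VT (addEdge M u w) ∣               ≤⟨ p⊆q⇒∣p∣≤∣q∣ (VT-addEdge M u w) ⟩
  ∣ VT M ∪ (⁅ u ⁆ ∪ ⁅ w ⁆) ∣           ≤⟨ ∣p∪q∣≤∣p∣+∣q∣ (VT M) _ ⟩
  ∣ VT M ∣ + ∣ ⁅ u ⁆ ∪ ⁅ w ⁆ ∣         ≤⟨ +-monoʳ-≤ ∣ VT M ∣ (∣p∪q∣≤∣p∣+∣q∣ ⁅ u ⁆ ⁅ w ⁆) ⟩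
  ∣ VT M ∣ + (∣ ⁅ u ⁆ ∣ + ∣ ⁅ w ⁆ ∣)   ≡⟨ cong₂ (λ a b → ∣ VT M ∣ + (a + b)) (∣⁅x⁆∣≡1 u) (∣⁅x⁆∣≡1 w) ⟩
  ∣ VT M ∣ + 2                         ≡⟨ +-comm ∣ VT M ∣ 2 ⟩
  2 + ∣ VT M ∣                         ∎
  where open ≤-Reasoning

module _ {n} (G : Graph n) where

  Adj-sym : ∀ {x y} → Adj G x y → Adj G y x
  Adj-sym {x} {y} = trans (Graph.sym G y x)

  Adj⇒≢ : ∀ {x y} → Adj G x y → x ≢ y
  Adj⇒≢ {x} Gxx refl = true≢false (trans (sym Gxx) (irrefl G x))

  IsMatching : EdgeFun n → Set
  IsMatching M = IsEdgeSet G M × (∀ x y z → M x y ≡ true → M x z ≡ true → y ≡ z)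

  IsEdgeSet⇒loopless : ∀ {M} → IsEdgeSet G M → ∀ x → M x x ≡ false
  IsEdgeSet⇒loopless (M⊆G , _) x = ¬-not λ Mxx → Adj⇒≢ (M⊆G x x Mxx) refl

  addEdge-matching : ∀ {M u w} → IsMatching M → Adj G u w → u ∉ VT M → w ∉ VT M →
                     IsMatching (addEdge M u w)
  addEdge-matching {M} {u} {w} ((M⊆G , symm) , unique) Guw u∉VT w∉VT =
    (M′⊆G , addEdge-sym symm) , unique′
    where
    M′⊆G : ∀ x y → addEdge M u w x y ≡ true → Adj G x y
    M′⊆G x y e with addEdge⁻ {M = M} e
    ... | inj₁ Mxy                  = M⊆G x y Mxy
    ... | inj₂ (inj₁ (refl , refl)) = Guw
    ... | inj₂ (inj₂ (refl , refl)) = Adj-sym Guw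
    unique′ : ∀ x y z → addEdge M u w x y ≡ true → addEdge M u w x z ≡ true → y ≡ z
    unique′ x y z e₁ e₂ with addEdge⁻ {M = M} e₁ | addEdge⁻ {M = M} e₂
    ... | inj₁ Mxy               | inj₁ Mxz               = unique x y z Mxy Mxz
    ... | inj₁ Mxy               | inj₂ (inj₁ (refl , _)) = ⊥-elim (u∉VT (∈VT⁺ M Mxy))
    ... | inj₁ Mxy               | inj₂ (inj₂ (refl , _)) = ⊥-elim (w∉VT (∈VT⁺ M Mxy))
    ... | inj₂ (inj₁ (refl , _)) | inj₁ Mxz               = ⊥-elim (u∉VT (∈VT⁺ M Mxz))
    ... | inj₂ (inj₂ (refl , _)) | inj₁ Mxz               = ⊥-elim (w∉VT (∈VT⁺ M Mxz))
    ... | inj₂ (inj₁ (_ , refl)) | inj₂ (inj₁ (_ , refl)) = refl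
    ... | inj₂ (inj₂ (_ , refl)) | inj₂ (inj₂ (_ , refl)) = refl
    ... | inj₂ (inj₁ (refl , _)) | inj₂ (inj₂ (x≡w , _)) = ⊥-elim (Adj⇒≢ Guw x≡w)
    ... | inj₂ (inj₂ (refl , _)) | inj₂ (inj₁ (x≡u , _)) = ⊥-elim (Adj⇒≢ Guw (sym x≡u))

  PerfectMatchingOf⇒IsMatching : ∀ {D M} → PerfectMatchingOf G D M → IsMatching M
  PerfectMatchingOf⇒IsMatching {M = M} (edgeSet , ends , mate) = edgeSet , unique
    where
    unique : ∀ x y z → M x y ≡ true → M x z ≡ true → y ≡ z
    unique x y z Mxy Mxz =
      let _ , _ , only = mate x (proj₁ (ends x y Mxy)) in trans (only y Mxy) (sym (only z Mxz))

  IsMatching⇒PerfectMatchingOf-VT : ∀ {M} → IsMatching M → PerfectMatchingOf G (VT M) M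
  IsMatching⇒PerfectMatchingOf-VT {M} (edgeSet@(_ , symm) , unique) = edgeSet , ends , mate
    where
    ends : ∀ x y → M x y ≡ true → x ∈ VT M × y ∈ VT M
    ends x y Mxy = ∈VT⁺ M Mxy , ∈VT⁺ M (trans (symm y x) Mxy)
    mate : ∀ x → x ∈ VT M → Σ (Fin n) λ y → M x y ≡ true × (∀ z → M x z ≡ true → z ≡ y)
    mate x x∈VT = let y , Mxy = ∈VT⁻ M x∈VT in y , Mxy , λ z Mxz → unique x z y Mxz Mxy

  PerfectMatchingOf⇒VT≡ : ∀ {D M} → PerfectMatchingOf G D M → VT M ≡ D
  PerfectMatchingOf⇒VT≡ {D} {M} (_ , ends , mate) = ⊆-antisym VT⊆D D⊆VT
    where
    VT⊆D : VT M ⊆ D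
    VT⊆D x∈VT = let y , Mxy = ∈VT⁻ M x∈VT in proj₁ (ends _ y Mxy)
    D⊆VT : D ⊆ VT M
    D⊆VT x∈D = ∈VT⁺ M (proj₁ (proj₂ (mate _ x∈D)))

  PerfectMatchingOf-size : ∀ {D M} → PerfectMatchingOf G D M → ∣ D ∣ ≡ 2 * edgeCount M
  PerfectMatchingOf-size {D} {M} (edgeSet , ends , mate) = begin
    ∣ D ∣                           ≡⟨ ∣p∣≡countFin D ⟩
    countFin (lookup D)             ≡⟨ countFin≡sum (lookup D) ⟩
    sum (ind ∘ lookup D)            ≡⟨ sum-cong-≗ degree ⟨
    sum (countFin ∘ M)              ≡⟨ sumFin≡sum (countFin ∘ M) ⟨
    sumFin (countFin ∘ M)           ≡⟨ handshake M (proj₂ edgeSet) (IsEdgeSet⇒loopless edgeSet) ⟩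
    2 * edgeCount M                 ∎
    where
    open ≡-Reasoning
    degree : ∀ u → countFin (M u) ≡ ind (lookup D u)
    degree u with lookup D u in u∈?D
    ... | true  = let v , Muv , only = mate u (lookup⇒[]= u D u∈?D) in countFin-≡1 (M u) Muv only
    ... | false = countFin-≡0 (M u) λ w → ¬-not λ Muw →
                    true≢false (trans (sym ([]=⇒lookup (proj₁ (ends u w Muw)))) u∈?D)

  PairedDominating⇒EVD : ∀ {D M} → Dominating G D → PerfectMatchingOf G D M →
                         EdgeVertexDominating G M
  PairedDominating⇒EVD {D} {M} dominating (edgeSet , _ , mate) = edgeSet , cover
    where
    cover : ∀ v → Σ (Fin n) λ u → Σ (Fin n) λ w → M u w ≡ true × EvDominates G u w v
    cover v with dominating v
    ... | inj₁ v∈D             = v , proj₁ (mate v v∈D) , proj₁ (proj₂ (mate v v∈D)) , inj₁ refl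
    ... | inj₂ (u , u∈D , Gvu) = u , proj₁ (mate u u∈D) , proj₁ (proj₂ (mate u u∈D)) , inj₂ (inj₂ (inj₁ Gvu))

  EVD⇒Dominating-VT : ∀ {M} → EdgeVertexDominating G M → Dominating G (VT M)
  EVD⇒Dominating-VT {M} ((_ , symm) , cover) v with cover v
  ... | u , w , Muw , inj₁ refl               = inj₁ (∈VT⁺ M Muw)
  ... | u , w , Muw , inj₂ (inj₁ refl)        = inj₁ (∈VT⁺ M (trans (symm w u) Muw))
  ... | u , w , Muw , inj₂ (inj₂ (inj₁ Gvu)) = inj₂ (u , ∈VT⁺ M Muw , Gvu)
  ... | u , w , Muw , inj₂ (inj₂ (inj₂ Gvw)) = inj₂ (w , ∈VT⁺ M (trans (symm w u) Muw) , Gvw)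

  EVD⇒edge : ∀ {M} → EdgeVertexDominating G M → Fin n → ∃ λ a → ∃ λ b → M a b ≡ true
  EVD⇒edge (_ , cover) v = let a , b , Mab , _ = cover v in a , b , Mab

-- Greedy pairing

Incident : ∀ {n} → Fin n → Fin n × Fin n → Set
Incident x (a , b) = x ≡ a ⊎ x ≡ b

-- An open vertex u is settled by matching it with an unmatched neighbour
-- (added to S if need be) or, if all its neighbours are matched, by removing
-- it from S: those neighbours lie in S and still dominate u.
module Greedy {n} (G : Graph n) (neighbour : ∀ v → ∃ (Adj G v)) where

  Open : Subset n → EdgeFun n → Fin n → Set
  Open S P x = x ∈ S × x ∉ VT P

  open? : ∀ S P x → Dec (Open S P x)
  open? S P x = x ∈? S ×-dec ¬? (x ∈? VT P)

  record PartialPairing (S : Subset n) (P : EdgeFun n) : Set where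
    field
      dominating : Dominating G S
      matching   : IsMatching G P
      VT⊆        : VT P ⊆ S

  record Refinement (S : Subset n) (P : EdgeFun n) (S′ : Subset n) (P′ : EdgeFun n) : Set where
    field
      pairing : PartialPairing S′ P′
      P⊆P′    : P ⊆ₑ P′
      growth  : ∣ VT P′ ∣ ≤ 2 + ∣ VT P ∣
      shrinks : ∀ {x} → Open S′ P′ x → Open S P x

  Settling : Subset n → EdgeFun n → (Fin n → Set) → Set
  Settling S P Done = Σ (Subset n) λ S′ → Σ (EdgeFun n) λ P′ →
                      Refinement S P S′ P′ × (∀ {x} → Done x → ¬ Open S′ P′ x)

  refinement-refl : ∀ {S P} → PartialPairing S P → Refinement S P S P
  refinement-refl pp = record { pairing = pp ; P⊆P′ = λ _ _ Pxy → Pxy ; growth = m≤n+m _ 2 ; shrinks = λ o → o }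

  pairStep : ∀ {S P u w} → PartialPairing S P → Open S P u → Adj G u w → w ∉ VT P →
             Refinement S P (S ∪ ⁅ w ⁆) (addEdge P u w)
  pairStep {S} {P} {u} {w} pp (u∈S , u∉VT) Guw w∉VT = record
    { pairing = record
      { dominating = λ v → Sum.map S⊆S′ (Prod.map₂ (Prod.map₁ S⊆S′)) (dominating v)
      ; matching   = addEdge-matching G matching Guw u∉VT w∉VT
      ; VT⊆        = VT′⊆S′ }
    ; P⊆P′    = addEdge⁺
    ; growth  = ∣VT-addEdge∣ P u w
    ; shrinks = shrinks }
    where
    open PartialPairing pp
    S⊆S′ : S ⊆ S ∪ ⁅ w ⁆
    S⊆S′ = p⊆p∪q ⁅ w ⁆
    VT′⊆S′ : VT (addEdge P u w) ⊆ S ∪ ⁅ w ⁆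
    VT′⊆S′ x∈VT′ with x∈p∪q⁻ _ _ (VT-addEdge P u w x∈VT′)
    ... | inj₁ x∈VT = S⊆S′ (VT⊆ x∈VT)
    ... | inj₂ x∈uw with x∈p∪q⁻ ⁅ u ⁆ ⁅ w ⁆ x∈uw
    ...   | inj₁ x∈u = S⊆S′ (subst (_∈ S) (sym (x∈⁅y⁆⇒x≡y u x∈u)) u∈S)
    ...   | inj₂ x∈w = x∈p∪q⁺ (inj₂ x∈w)
    shrinks : ∀ {x} → Open (S ∪ ⁅ w ⁆) (addEdge P u w) x → Open S P x
    shrinks (x∈S′ , x∉VT′) with x∈p∪q⁻ S ⁅ w ⁆ x∈S′
    ... | inj₁ x∈S = x∈S , x∉VT′ ∘ VT-mono addEdge⁺
    ... | inj₂ x∈w with refl ← x∈⁅y⁆⇒x≡y w x∈w = ⊥-elim (x∉VT′ (∈VT⁺ _ (addEdge-new′ {M = P} {u})))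

  pairStep-settles : ∀ {S P u w x} → Incident x (u , w) → ¬ Open S (addEdge P u w) x
  pairStep-settles {P = P} {u} {w} (inj₁ refl) (_ , x∉VT) = x∉VT (∈VT⁺ _ (addEdge-new {M = P} {u} {w}))
  pairStep-settles {P = P} {u} {w} (inj₂ refl) (_ , x∉VT) = x∉VT (∈VT⁺ _ (addEdge-new′ {M = P} {u} {w}))

  dropStep : ∀ {S P u} → PartialPairing S P → Open S P u → (∀ w → Adj G u w → w ∈ VT P) →
             Refinement S P (S - u) P
  dropStep {S} {P} {u} pp (u∈S , u∉VT) nbrs⊆VT = record
    { pairing = record { dominating = dominating′ ; matching = matching ; VT⊆ = VT⊆S-u }
    ; P⊆P′    = λ _ _ Pxy → Pxy
    ; growth  = m≤n+m _ 2
    ; shrinks = Prod.map₁ (p─q⊆p S ⁅ u ⁆) }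
    where
    open PartialPairing pp
    VT⊆S-u : VT P ⊆ S - u
    VT⊆S-u x∈VT = x∈p∧x≢y⇒x∈p-y (VT⊆ x∈VT) λ { refl → u∉VT x∈VT }
    dominating′ : Dominating G (S - u)
    dominating′ v with v ≟ᶠ u
    ... | yes refl = let w , Guw = neighbour u in inj₂ (w , VT⊆S-u (nbrs⊆VT w Guw) , Guw)
    ... | no v≢u with dominating v
    ...   | inj₁ v∈S = inj₁ (x∈p∧x≢y⇒x∈p-y v∈S v≢u)
    ...   | inj₂ (y , y∈S , Gvy) with y ≟ᶠ u
    ...     | yes refl = inj₁ (VT⊆S-u (nbrs⊆VT v (Adj-sym G Gvy)))
    ...     | no y≢u   = inj₂ (y , x∈p∧x≢y⇒x∈p-y y∈S y≢u , Gvy)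

  settleVertex : ∀ {S P u} → PartialPairing S P → Open S P u → Settling S P (_≡ u)
  settleVertex {S} {P} {u} pp open-u with any? (λ w → (adj G u w Bool.≟ true) ×-dec ¬? (w ∈? VT P))
  ... | yes (w , Guw , w∉VT) =
        S ∪ ⁅ w ⁆ , addEdge P u w , pairStep pp open-u Guw w∉VT ,
        λ { refl → pairStep-settles {P = P} {w = w} (inj₁ refl) }
  ... | no none =
        S - u , P , dropStep pp open-u nbrs⊆VT , λ { refl (u∈S-u , _) → x∉p-x u S u∈S-u }
    where
    nbrs⊆VT : ∀ w → Adj G u w → w ∈ VT P
    nbrs⊆VT w Guw with w ∈? VT P
    ... | yes w∈VT = w∈VT
    ... | no w∉VT  = ⊥-elim (none (w , Guw , w∉VT))

  settleEdge : ∀ {S P a b} → PartialPairing S P → Adj G a b → Settling S P (λ x → Incident x (a , b))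
  settleEdge {S} {P} {a} {b} pp Gab with open? S P a | open? S P b
  -- Settling a on its own might match it elsewhere and leave b open.
  ... | yes open-a | yes open-b = _ , _ , pairStep pp open-a Gab (proj₂ open-b) , pairStep-settles {P = P}
  ... | yes open-a | no ¬open-b =
        let S′ , P′ , ref , done = settleVertex pp open-a in
        S′ , P′ , ref , λ { (inj₁ refl) → done refl ; (inj₂ refl) → ¬open-b ∘ Refinement.shrinks ref }
  ... | no ¬open-a | yes open-b =
        let S′ , P′ , ref , done = settleVertex pp open-b in
        S′ , P′ , ref , λ { (inj₁ refl) → ¬open-a ∘ Refinement.shrinks ref ; (inj₂ refl) → done refl }
  ... | no ¬open-a | no ¬open-b =
        S , P , refinement-refl pp , λ { (inj₁ refl) → ¬open-a ; (inj₂ refl) → ¬open-b }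

  Completion : Subset n → EdgeFun n → ℕ → Set
  Completion S P k = Σ (Subset n) λ D → Σ (EdgeFun n) λ Q →
                     Dominating G D × PerfectMatchingOf G D Q × P ⊆ₑ Q × ∣ D ∣ ≤ ∣ VT P ∣ + 2 * k

  pairUp : ∀ {S P} → PartialPairing S P → (L : List (Fin n × Fin n)) → All (uncurry (Adj G)) L →
           (∀ {x} → Open S P x → Any (Incident x) L) → Completion S P (length L)
  pairUp {S} {P} pp [] [] covered = S , P , dominating , pm , (λ _ _ Pxy → Pxy) , size
    where
    open PartialPairing pp
    S⊆VT : S ⊆ VT P
    S⊆VT {x} x∈S with x ∈? VT P
    ... | yes x∈VT = x∈VT
    ... | no x∉VT with () ← covered (x∈S , x∉VT)
    pm : PerfectMatchingOf G S P
    pm = subst (λ D → PerfectMatchingOf G D P) (⊆-antisym VT⊆ S⊆VT)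
               (IsMatching⇒PerfectMatchingOf-VT G matching)
    size : ∣ S ∣ ≤ ∣ VT P ∣ + 2 * 0
    size = ≤-trans (p⊆q⇒∣p∣≤∣q∣ S⊆VT) (m≤m+n _ _)
  pairUp {S} {P} pp ((a , b) ∷ L) (Gab ∷ adjacent) covered = extend (settleEdge pp Gab)
    where
    extend : Settling S P (λ x → Incident x (a , b)) → Completion S P (suc (length L))
    extend (S′ , P′ , ref , done) = lift (pairUp pairing L adjacent covered′)
      where
      open Refinement ref
      covered′ : ∀ {x} → Open S′ P′ x → Any (Incident x) L
      covered′ o with covered (shrinks o)
      ... | here incident = ⊥-elim (done incident o)
      ... | there any     = any
      budget : ∀ k l → 2 + k + 2 * l ≡ k + 2 * suc l
      budget = solve-∀
      lift : Completion S′ P′ (length L) → Completion S P (suc (length L))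
      lift (D , Q , dominating′ , pm , P′⊆Q , size) =
        D , Q , dominating′ , pm , (λ x y → P′⊆Q x y ∘ P⊆P′ x y) ,
        ≤-trans size (≤-trans (+-monoˡ-≤ _ growth) (≤-reflexive (budget ∣ VT P ∣ (length L))))

support : ∀ {n} → (Fin n → Bool) → List (Fin n)
support {zero}  f = []
support {suc n} f = if f zero then zero ∷ rest else rest
  where
  rest : List (Fin (suc n))
  rest = List.map suc (support (f ∘ suc))

length-support : ∀ {n} (f : Fin n → Bool) → length (support f) ≡ countFin f
length-support {zero}  f = refl
length-support {suc n} f with f zero
... | true  = cong suc (trans (length-map suc (support (f ∘ suc))) (length-support (f ∘ suc)))
... | false = trans (length-map suc (support (f ∘ suc))) (length-support (f ∘ suc))

∈-support⁺ : ∀ {n} (f : Fin n → Bool) {x} → f x ≡ true → x ∈ₗ support f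
∈-support⁺ f {zero}  fx rewrite fx = here refl
∈-support⁺ f {suc x} fx with f zero
... | true  = there (∈-map⁺ suc (∈-support⁺ (f ∘ suc) fx))
... | false = ∈-map⁺ suc (∈-support⁺ (f ∘ suc) fx)

∈-support⁻ : ∀ {n} (f : Fin n → Bool) {x} → x ∈ₗ support f → f x ≡ true
∈-support⁻ {suc n} f x∈ with f zero in f0
∈-support⁻ {suc n} f (here refl) | true  = f0
∈-support⁻ {suc n} f (there x∈)  | true  with _ , y∈ , refl ← ∈-map⁻ suc x∈ = ∈-support⁻ (f ∘ suc) y∈
∈-support⁻ {suc n} f x∈          | false with _ , y∈ , refl ← ∈-map⁻ suc x∈ = ∈-support⁻ (f ∘ suc) y∈

concatFin : ∀ {a} {A : Set a} {n} → (Fin n → List A) → List A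
concatFin {n = zero}  g = []
concatFin {n = suc n} g = g zero ++ concatFin (g ∘ suc)

module _ {a} {A : Set a} where

  length-concatFin : ∀ {n} (g : Fin n → List A) → length (concatFin g) ≡ sumFin (length ∘ g)
  length-concatFin {zero}  g = refl
  length-concatFin {suc n} g =
    trans (length-++ (g zero)) (cong (length (g zero) +_) (length-concatFin (g ∘ suc)))

  ∈-concatFin⁺ : ∀ {n} (g : Fin n → List A) {u x} → x ∈ₗ g u → x ∈ₗ concatFin g
  ∈-concatFin⁺ g {zero}  x∈ = ∈-++⁺ˡ x∈
  ∈-concatFin⁺ g {suc u} x∈ = ∈-++⁺ʳ (g zero) (∈-concatFin⁺ (g ∘ suc) x∈)

  ∈-concatFin⁻ : ∀ {n} (g : Fin n → List A) {x} → x ∈ₗ concatFin g → ∃ λ u → x ∈ₗ g u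
  ∈-concatFin⁻ {suc n} g x∈ with ∈-++⁻ (g zero) x∈
  ... | inj₁ x∈g₀ = zero , x∈g₀
  ... | inj₂ x∈gₛ = let u , x∈gᵤ = ∈-concatFin⁻ (g ∘ suc) x∈gₛ in suc u , x∈gᵤ

edgesFrom : ∀ {n} → EdgeFun n → Fin n → List (Fin n × Fin n)
edgesFrom M u = List.map (u ,_) (support (Ascending M u))

edgeList : ∀ {n} → EdgeFun n → List (Fin n × Fin n)
edgeList M = concatFin (edgesFrom M)

length-edgeList : ∀ {n} (M : EdgeFun n) → length (edgeList M) ≡ edgeCount M
length-edgeList M = trans (length-concatFin (edgesFrom M)) (sumFin-cong λ u →
  trans (length-map (u ,_) (support (Ascending M u))) (length-support (Ascending M u)))

∈-edgeList⁺ : ∀ {n} (M : EdgeFun n) {u v} → Ascending M u v ≡ true → (u , v) ∈ₗ edgeList M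
∈-edgeList⁺ M {u} asc = ∈-concatFin⁺ (edgesFrom M) {u} (∈-map⁺ (u ,_) (∈-support⁺ (Ascending M u) asc))

∈-edgeList⁻ : ∀ {n} (M : EdgeFun n) {u v} → (u , v) ∈ₗ edgeList M → M u v ≡ true
∈-edgeList⁻ M {u} {v} e∈
  with u′ , e∈row ← ∈-concatFin⁻ (edgesFrom M) e∈
  with v′ , v′∈ , refl ← ∈-map⁻ (u′ ,_) e∈row
  with toℕ u <ᵇ toℕ v | ∈-support⁻ (Ascending M u) v′∈
... | true | Muv = Muv

∈-edgeList : ∀ {n} (G : Graph n) {M x y} → IsEdgeSet G M → M x y ≡ true →
             (x , y) ∈ₗ edgeList M ⊎ (y , x) ∈ₗ edgeList M
∈-edgeList G {M} {x} {y} (M⊆G , symm) Mxy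
  with toℕ x <ᵇ toℕ y in x<y | orientation x y (Adj⇒≢ G (M⊆G x y Mxy))
... | true  | _   = inj₁ (∈-edgeList⁺ M (cong₂ _∧_ x<y Mxy))
... | false | y<x = inj₂ (∈-edgeList⁺ M (cong₂ _∧_ y<x (trans (symm y x) Mxy)))

module _ {n} (G : Graph n) (neighbour : ∀ v → ∃ (Adj G v)) where
  open Greedy G neighbour

  PairingThrough : EdgeFun n → Fin n → Fin n → Set
  PairingThrough M a b = Σ (Subset n) λ D → Σ (EdgeFun n) λ Q →
    Dominating G D × PerfectMatchingOf G D Q × Q a b ≡ true × ∣ D ∣ ≤ 2 * edgeCount M

  -- The edge ab is matched first; the list entry e₀ representing it is then
  -- no longer needed, which pays for the two vertices a and b.
  private
    fromEntry : ∀ {M a b e₀} → EdgeVertexDominating G M → M a b ≡ true → e₀ ∈ₗ edgeList M →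
                (∀ {x} → Incident x e₀ → Incident x (a , b)) → PairingThrough M a b
    fromEntry {M} {a} {b} {e₀} evd@(edgeSet@(M⊆G , _) , _) Mab e₀∈ e₀-ends =
      let ys , zs , split = ∈-∃++ e₀∈ in finish ys zs split
      where
      start : PartialPairing (VT M) noEdges
      start = record
        { dominating = EVD⇒Dominating-VT G evd
        ; matching   = ((λ _ _ ()) , λ _ _ → refl) , λ _ _ _ ()
        ; VT⊆        = ⊥-elim ∘ ∉VT-noEdges }
      first : Refinement (VT M) noEdges (VT M ∪ ⁅ b ⁆) (addEdge noEdges a b)
      first = pairStep start (∈VT⁺ M Mab , ∉VT-noEdges) (M⊆G a b Mab) ∉VT-noEdges
      open Refinement first
      finish : ∀ ys zs → edgeList M ≡ ys ++ e₀ ∷ zs → PairingThrough M a b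
      finish ys zs split = conclude (pairUp pairing (ys ++ zs) adjacent covered)
        where
        inList : ∀ {e} → e ∈ₗ ys ++ zs → e ∈ₗ edgeList M
        inList e∈ with ∈-++⁻ ys e∈
        ... | inj₁ e∈ys = subst (_ ∈ₗ_) (sym split) (∈-++⁺ˡ e∈ys)
        ... | inj₂ e∈zs = subst (_ ∈ₗ_) (sym split) (∈-++⁺ʳ ys (there e∈zs))
        adjacent : All (uncurry (Adj G)) (ys ++ zs)
        adjacent = All.tabulate λ e∈ → M⊆G _ _ (∈-edgeList⁻ M (inList e∈))
        keep : ∀ {x e} → Open (VT M ∪ ⁅ b ⁆) (addEdge noEdges a b) x →
               e ∈ₗ edgeList M → Incident x e → Any (Incident x) (ys ++ zs)
        keep o e∈ incident with ∈-++⁻ ys (subst (_ ∈ₗ_) split e∈)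
        ... | inj₁ e∈ys         = lose (∈-++⁺ˡ e∈ys) incident
        ... | inj₂ (here refl)  = ⊥-elim (pairStep-settles {P = noEdges} (e₀-ends incident) o)
        ... | inj₂ (there e∈zs) = lose (∈-++⁺ʳ ys e∈zs) incident
        covered : ∀ {x} → Open (VT M ∪ ⁅ b ⁆) (addEdge noEdges a b) x → Any (Incident x) (ys ++ zs)
        covered o with ∈VT⁻ M (proj₁ (shrinks o))
        ... | y , Mxy with ∈-edgeList G edgeSet Mxy
        ...   | inj₁ xy∈ = keep o xy∈ (inj₁ refl)
        ...   | inj₂ yx∈ = keep o yx∈ (inj₂ refl)
        conclude : Completion (VT M ∪ ⁅ b ⁆) (addEdge noEdges a b) (length (ys ++ zs)) → PairingThrough M a b
        conclude (D , Q , dominating , pm , P⊆Q , size) =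
          D , Q , dominating , pm , P⊆Q a b (addEdge-new {M = noEdges} {a} {b}) , (begin
            ∣ D ∣                                  ≤⟨ size ⟩
            ∣ VT (addEdge noEdges a b) ∣ + 2 * l   ≤⟨ +-monoˡ-≤ (2 * l) (≤-trans growth (+-monoʳ-≤ 2 (∣VT-noEdges∣ {n}))) ⟩
            2 + 0 + 2 * l                          ≡⟨ *-suc 2 l ⟨
            2 * suc l                              ≡⟨ cong (2 *_) (trans (cong length split) (length-++-sucʳ ys e₀ zs)) ⟨
            2 * length (edgeList M)                ≡⟨ cong (2 *_) (length-edgeList M) ⟩
            2 * edgeCount M                        ∎)
          where
          open ≤-Reasoning
          l : ℕ
          l = length (ys ++ zs)

  pairingThrough : ∀ {M a b} → EdgeVertexDominating G M → M a b ≡ true → PairingThrough M a b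
  pairingThrough evd Mab with ∈-edgeList G (proj₁ evd) Mab
  ... | inj₁ ab∈ = fromEntry evd Mab ab∈ (λ incident → incident)
  ... | inj₂ ba∈ = fromEntry evd Mab ba∈ Sum.swap

-- Cycles from non-backtracking walks

leastWitness : ∀ {p} {P : ℕ → Set p} → U.Decidable P → ∀ {k} → P k →
               ∃ λ j → P j × (∀ {i} → i < j → ¬ P i)
leastWitness {P = P} P? {k} Pk = search 0 k (λ ()) Pk
  where
  search : ∀ m f → (∀ {i} → i < m → ¬ P i) → P (m + f) → ∃ λ j → P j × (∀ {i} → i < j → ¬ P i)
  search m zero    below Pm+0 = m , subst P (+-identityʳ m) Pm+0 , below
  search m (suc f) below Pm+f with P? m
  ... | yes Pm = m , Pm , below
  ... | no ¬Pm = search (suc m) f below′ (subst P (+-suc m f) Pm+f)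
    where
    below′ : ∀ {i} → i < suc m → ¬ P i
    below′ {i} i<1+m with i ℕ.≟ m
    ... | yes refl = ¬Pm
    ... | no i≢m   = below (≤∧≢⇒< (s≤s⁻¹ i<1+m) i≢m)

module _ {a} {A : Set a} where

  path : (ℕ → A) → ℕ → List A
  path y zero    = []
  path y (suc m) = y 0 ∷ path (y ∘ suc) m

  path-∷ʳ : ∀ (y : ℕ → A) m → path y m ∷ʳ y m ≡ path y (suc m)
  path-∷ʳ y zero    = refl
  path-∷ʳ y (suc m) = cong (y 0 ∷_) (path-∷ʳ (y ∘ suc) m)

  path-linked : ∀ {r} {R : A → A → Set r} (y : ℕ → A) → (∀ t → R (y t) (y (suc t))) →
                ∀ m → Linked R (path y m)
  path-linked y step zero          = []
  path-linked y step (suc zero)    = [-]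
  path-linked y step (suc (suc m)) = step 0 ∷ path-linked (y ∘ suc) (step ∘ suc) (suc m)

  path-all : ∀ {p} {P : A → Set p} (y : ℕ → A) m → (∀ {t} → t < m → P (y t)) → All P (path y m)
  path-all y zero    _   = []
  path-all y (suc m) all = all z<s ∷ path-all (y ∘ suc) m (all ∘ s<s)

  path-unique : ∀ (y : ℕ → A) m → (∀ {i j} → i < j → j < m → y i ≢ y j) → Unique (path y m)
  path-unique y zero    _        = []
  path-unique y (suc m) distinct =
    path-all (y ∘ suc) m (λ t<m → distinct z<s (s<s t<m)) ∷
    path-unique (y ∘ suc) m (λ i<j j<m → distinct (s<s i<j) (s<s j<m))

module _ {n} (G : Graph n) where

  closedWalk⇒HasCycle : ∀ (y : ℕ → Fin n) l → (∀ t → Adj G (y t) (y (suc t))) → y (3 + l) ≡ y 0 →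
                        (∀ {i j} → i < j → j < 3 + l → y i ≢ y j) → HasCycle G
  closedWalk⇒HasCycle y l step closed distinct =
    y 0 , path (y ∘ suc) (2 + l) , s≤s (s≤s (s≤s z≤n)) , path-unique y (3 + l) distinct ,
    subst (Linked (Adj G)) (trans (sym (path-∷ʳ y (3 + l))) (cong (path y (3 + l) ∷ʳ_) closed))
          (path-linked y step (4 + l))

  module _ (x : ℕ → Fin n) (step : ∀ t → Adj G (x t) (x (suc t))) (noReturn : ∀ t → x (2 + t) ≢ x t) where

    private
      Repeat : ℕ → Set
      Repeat j = ∃ λ i → i < j × x i ≡ x j

      repeat? : U.Decidable Repeat
      repeat? j = anyUpTo? (λ i → x i ≟ᶠ x j) j

      firstRepeat : Repeat _
      firstRepeat = let i , j , i<j , xi≡xj = pigeonhole (n<1+n n) (x ∘ toℕ) in toℕ i , i<j , xi≡xj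

      cycleFrom : ∀ i d → x i ≡ x (suc i + d) → (∀ {j} → j < suc i + d → ¬ Repeat j) → HasCycle G
      cycleFrom i zero xi≡ _ = ⊥-elim (Adj⇒≢ G (step i) (trans xi≡ (cong x (+-identityʳ (suc i)))))
      cycleFrom i (suc zero) xi≡ _ = ⊥-elim (noReturn i (sym (trans xi≡ (cong (x ∘ suc) (+-comm i 1)))))
      cycleFrom i (suc (suc l)) xi≡ noEarlier = closedWalk⇒HasCycle y l step′ closed distinct
        where
        y : ℕ → Fin n
        y t = x (i + t)
        step′ : ∀ t → Adj G (y t) (y (suc t))
        step′ t = subst (Adj G (y t) ∘ x) (sym (+-suc i t)) (step (i + t))
        closed : y (3 + l) ≡ y 0
        closed = trans (cong x (+-suc i (2 + l))) (trans (sym xi≡) (cong x (sym (+-identityʳ i))))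
        distinct : ∀ {a b} → a < b → b < 3 + l → y a ≢ y b
        distinct {a} {b} a<b b<3+l ya≡yb =
          noEarlier (subst (i + b <_) (+-suc i (2 + l)) (+-monoʳ-< i b<3+l)) (i + a , +-monoʳ-< i a<b , ya≡yb)

    nonBacktracking⇒HasCycle : HasCycle G
    nonBacktracking⇒HasCycle =
      let j , (i , i<j , xi≡xj) , noEarlier = leastWitness repeat? firstRepeat
          d , 1+i+d≡j = m≤n⇒∃[o]m+o≡n i<j
      in cycleFrom i d (trans xi≡xj (cong x (sym 1+i+d≡j))) (noEarlier ∘ subst (_ <_) 1+i+d≡j)

module _ {n} (G : Graph n) {D : Subset n} {Q₁ Q₂ : EdgeFun n}
         (pm₁ : PerfectMatchingOf G D Q₁) (pm₂ : PerfectMatchingOf G D Q₂) where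

  private
    Q : Bool → EdgeFun n
    Q true  = Q₁
    Q false = Q₂

    pm : ∀ b → PerfectMatchingOf G D (Q b)
    pm true  = pm₁
    pm false = pm₂

    symm : ∀ b y z → Q b y z ≡ Q b z y
    symm b = proj₂ (proj₁ (PerfectMatchingOf⇒IsMatching G (pm b)))

    partner-unique : ∀ b {y z w} → Q b y z ≡ true → Q b y w ≡ true → z ≡ w
    partner-unique b = proj₂ (PerfectMatchingOf⇒IsMatching G (pm b)) _ _ _

    Vertex : Set
    Vertex = Σ (Fin n) (_∈ D)

    mate : Bool → Vertex → Vertex
    mate b (y , y∈D) = let z , Qyz , _ = proj₂ (proj₂ (pm b)) y y∈D in z , proj₂ (proj₁ (proj₂ (pm b)) y z Qyz)

    mate-edge : ∀ b v → Q b (proj₁ v) (proj₁ (mate b v)) ≡ true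
    mate-edge b (y , y∈D) = proj₁ (proj₂ (proj₂ (proj₂ (pm b)) y y∈D))

    phase : ℕ → Bool
    phase zero    = true
    phase (suc t) = not (phase t)

  alternatingCycle : ∀ {u v} → Q₁ u v ≡ true → Q₂ u v ≡ false → HasCycle G
  alternatingCycle {u} {v} Q₁uv Q₂uv = nonBacktracking⇒HasCycle G x step noReturn
    where
    walk : ℕ → Vertex
    walk zero    = u , proj₁ (proj₁ (proj₂ pm₁) u v Q₁uv)
    walk (suc t) = mate (phase t) (walk t)
    x : ℕ → Fin n
    x = proj₁ ∘ walk
    edge : ∀ t → Q (phase t) (x t) (x (suc t)) ≡ true
    edge t = mate-edge (phase t) (walk t)
    step : ∀ t → Adj G (x t) (x (suc t))
    step t = proj₁ (proj₁ (pm (phase t))) _ _ (edge t)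
    -- Turning back after step t + 1 puts the edge of step t + 1 into both
    -- matchings, so the walk already turned back after step t; after step 0
    -- it would put uv into Q₂.
    noReturn : ∀ t → x (2 + t) ≢ x t
    noReturn zero x₂≡u = true≢false (trans (sym (trans (symm false u v) Q₂vu)) Q₂uv)
      where
      Q₂vu : Q₂ v u ≡ true
      Q₂vu = subst₂ (λ y z → Q₂ y z ≡ true) (partner-unique true (edge 0) Q₁uv) x₂≡u (edge 1)
    noReturn (suc t) x₃≡x₁ = noReturn t (partner-unique (phase t) forward backward)
      where
      forward : Q (phase t) (x (suc t)) (x (2 + t)) ≡ true
      forward = trans (symm (phase t) _ _)
        (subst (λ b → Q b (x (2 + t)) (x (suc t)) ≡ true) (not-involutive (phase t))
          (subst (λ z → Q (phase (2 + t)) (x (2 + t)) z ≡ true) x₃≡x₁ (edge (2 + t))))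
      backward : Q (phase t) (x (suc t)) (x t) ≡ true
      backward = trans (symm (phase t) _ _) (edge t)

perfectMatching-unique : ∀ {n} (G : Graph n) → Acyclic G → ∀ {D Q₁ Q₂} →
                         PerfectMatchingOf G D Q₁ → PerfectMatchingOf G D Q₂ → Q₁ ≐ Q₂
perfectMatching-unique G acyclic {Q₁ = Q₁} {Q₂} pm₁ pm₂ u v with Q₁ u v in Q₁uv | Q₂ u v in Q₂uv
... | true  | true  = refl
... | false | false = refl
... | true  | false = ⊥-elim (acyclic (alternatingCycle G pm₁ pm₂ Q₁uv Q₂uv))
... | false | true  = ⊥-elim (acyclic (alternatingCycle G pm₂ pm₁ Q₂uv Q₁uv))

-- Unique minimum sets

anotherVertex : ∀ {n} → 2 ≤ n → (v : Fin n) → ∃ λ u → u ≢ v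
anotherVertex (s≤s (s≤s z≤n)) zero    = suc zero , λ ()
anotherVertex (s≤s (s≤s z≤n)) (suc v) = zero , λ ()

connected⇒neighbour : ∀ {n} (G : Graph n) → Connected G → 2 ≤ n → ∀ v → ∃ (Adj G v)
connected⇒neighbour G connected 2≤n v with anotherVertex 2≤n v
... | u , u≢v with connected v u
...   | inj₁ v≡u               = ⊥-elim (u≢v (sym v≡u))
...   | inj₂ ([]    , Gvu ∷ _) = u , Gvu
...   | inj₂ (w ∷ _ , Gvw ∷ _) = w , Gvw

module _ {n} (G : Graph n) where

  UniqueMinPD-≤⇒≡ : ∀ {D D′} → UniqueMinPairedDominating G D → PairedDominating G D′ →
                    ∣ D′ ∣ ≤ ∣ D ∣ → D′ ≡ D
  UniqueMinPD-≤⇒≡ ((_ , minimal) , unique) pd′ D′≤D =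
    unique _ (pd′ , λ D″ pd″ → ≤-trans D′≤D (minimal D″ pd″))

  ≤MinEVD⇒MinEVD : ∀ {M M′} → MinEdgeVertexDominating G M → EdgeVertexDominating G M′ →
                   edgeCount M′ ≤ edgeCount M → MinEdgeVertexDominating G M′
  ≤MinEVD⇒MinEVD (_ , minimal) evd′ M′≤M = evd′ , λ M″ evd″ → ≤-trans M′≤M (minimal M″ evd″)

module _ {n} (G : Graph n) (neighbour : ∀ v → ∃ (Adj G v)) (v₀ : Fin n) where

  ∣minPD∣≤2*edgeCount : ∀ {D M} → MinPairedDominating G D → EdgeVertexDominating G M →
                        ∣ D ∣ ≤ 2 * edgeCount M
  ∣minPD∣≤2*edgeCount (_ , minimal) evd =
    let a , b , Mab = EVD⇒edge G evd v₀
        D′ , Q′ , dominating′ , pm′ , _ , size′ = pairingThrough G neighbour evd Mab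
    in ≤-trans (minimal D′ (dominating′ , Q′ , pm′)) size′

  uniquePD⇒uniqueEVD : Acyclic G → ∀ D → UniqueMinPairedDominating G D →
    Σ (EdgeFun n) λ M →
      UniqueMinEdgeVertexDominating G M
      × PerfectMatchingOf G D M
      × (∀ M′ → PerfectMatchingOf G D M′ → M′ ≐ M)
      × VT M ≡ D
  uniquePD⇒uniqueEVD acyclic D uniqueD@(minD@((dominating , M , pm) , _) , _) =
    M , ((evd , minimalM) , uniqueM) , pm , (λ M′ pm′ → perfectMatching-unique G acyclic pm′ pm) ,
    PerfectMatchingOf⇒VT≡ G pm
    where
    evd : EdgeVertexDominating G M
    evd = PairedDominating⇒EVD G dominating pm
    size : ∣ D ∣ ≡ 2 * edgeCount M
    size = PerfectMatchingOf-size G pm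
    minimalM : ∀ M′ → EdgeVertexDominating G M′ → edgeCount M ≤ edgeCount M′
    minimalM M′ evd′ = *-cancelˡ-≤ 2 (subst (_≤ 2 * edgeCount M′) size (∣minPD∣≤2*edgeCount minD evd′))
    uniqueM : ∀ M′ → MinEdgeVertexDominating G M′ → M′ ≐ M
    uniqueM M′ (evd′@(edgeSet′ , _) , minimalM′) = perfectMatching-unique G acyclic pmD pm
      where
      -- Each edge of M′ is matched in a paired-dominating set of size at most
      -- 2|M′| ≤ |D|, which is therefore D, matched by M.
      M′⊆M : M′ ⊆ₑ M
      M′⊆M a b M′ab =
        let D₁ , Q₁ , dominating₁ , pm₁ , Q₁ab , size₁ = pairingThrough G neighbour evd′ M′ab
            D₁≡D = UniqueMinPD-≤⇒≡ G uniqueD (dominating₁ , Q₁ , pm₁)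
                     (≤-trans size₁ (≤-trans (*-monoʳ-≤ 2 (minimalM′ M evd)) (≤-reflexive (sym size))))
            pm₁′ = subst (λ X → PerfectMatchingOf G X Q₁) D₁≡D pm₁
        in trans (sym (perfectMatching-unique G acyclic pm₁′ pm a b)) Q₁ab
      pmVT : PerfectMatchingOf G (VT M′) M′
      pmVT = IsMatching⇒PerfectMatchingOf-VT G (edgeSet′ , λ x y z M′xy M′xz →
               proj₂ (PerfectMatchingOf⇒IsMatching G pm) x y z (M′⊆M x y M′xy) (M′⊆M x z M′xz))
      VT≡D : VT M′ ≡ D
      VT≡D = UniqueMinPD-≤⇒≡ G uniqueD (EVD⇒Dominating-VT G evd′ , M′ , pmVT)
               (p⊆q⇒∣p∣≤∣q∣ (subst (VT M′ ⊆_) (PerfectMatchingOf⇒VT≡ G pm) (VT-mono M′⊆M)))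
      pmD : PerfectMatchingOf G D M′
      pmD = subst (λ X → PerfectMatchingOf G X M′) VT≡D pmVT

  uniqueEVD⇒uniquePD : ∀ M → UniqueMinEdgeVertexDominating G M → UniqueMinPairedDominating G (VT M)
  uniqueEVD⇒uniquePD M ((evd , minimalM) , uniqueM) =
    let a , b , Mab = EVD⇒edge G evd v₀ in fromPairing (pairingThrough G neighbour evd Mab)
    where
    -- The matching of such a set is a minimum ev-dominating set, i.e. M.
    matchedBy : ∀ {D′ Q′} → Dominating G D′ → PerfectMatchingOf G D′ Q′ → ∣ D′ ∣ ≤ 2 * edgeCount M →
                VT M ≡ D′
    matchedBy {D′} {Q′} dominating′ pm′ D′≤2M = trans (sym (VT-cong (uniqueM Q′ minimalQ′))) (PerfectMatchingOf⇒VT≡ G pm′)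
      where
      minimalQ′ : MinEdgeVertexDominating G Q′
      minimalQ′ = ≤MinEVD⇒MinEVD G (evd , minimalM) (PairedDominating⇒EVD G dominating′ pm′)
                    (*-cancelˡ-≤ 2 (subst (_≤ 2 * edgeCount M) (PerfectMatchingOf-size G pm′) D′≤2M))
    fromPairing : ∀ {a b} → PairingThrough G neighbour M a b → UniqueMinPairedDominating G (VT M)
    fromPairing (D₀ , Q₀ , dominating₀ , pm₀ , _ , size₀) = (pd , minimal) , unique
      where
      VT≡D₀ : VT M ≡ D₀
      VT≡D₀ = matchedBy dominating₀ pm₀ size₀
      pd : PairedDominating G (VT M)
      pd = subst (PairedDominating G) (sym VT≡D₀) (dominating₀ , Q₀ , pm₀)
      minimal : ∀ D′ → PairedDominating G D′ → ∣ VT M ∣ ≤ ∣ D′ ∣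
      minimal D′ (dominating′ , Q′ , pm′) = subst (_≤ ∣ D′ ∣) (cong ∣_∣ (sym VT≡D₀))
        (≤-trans size₀ (≤-trans (*-monoʳ-≤ 2 (minimalM Q′ (PairedDominating⇒EVD G dominating′ pm′)))
                                (≤-reflexive (sym (PerfectMatchingOf-size G pm′)))))
      unique : ∀ D′ → MinPairedDominating G D′ → D′ ≡ VT M
      unique D′ ((dominating′ , Q′ , pm′) , minimalD′) =
        sym (matchedBy dominating′ pm′ (≤-trans (minimalD′ D₀ (dominating₀ , Q₀ , pm₀)) size₀))

corollary5 : ∀ {n : ℕ} (T : Graph n) → IsTree T → 2 ≤ n →
    (∀ (D : Subset n) → UniqueMinPairedDominating T D →
       Σ (EdgeFun n) λ M →
         UniqueMinEdgeVertexDominating T M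
         × PerfectMatchingOf T D M
         × (∀ (M' : EdgeFun n) → PerfectMatchingOf T D M' → M' ≐ M)
         × VT M ≡ D)
    × (∀ (M : EdgeFun n) → UniqueMinEdgeVertexDominating T M →
         UniqueMinPairedDominating T (VT M))
corollary5 T (connected , acyclic) 2≤n =
  uniquePD⇒uniqueEVD T neighbour v₀ acyclic , uniqueEVD⇒uniquePD T neighbour v₀
  where
  neighbour : ∀ v → ∃ (Adj T v)
  neighbour = connected⇒neighbour T connected 2≤n
  v₀ : Fin _
  v₀ = Fin.fromℕ< 2≤n
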